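{- Let $G$ be a graph and let $G_n,\dots,G_1$ be the trigraphs of a $1$-contraction sequence of $G$. Then the underlying graphs of $G_n,\dots,G_1$ form a chain for the induced subgraph relation: for every $i\in\{2,\dots,n\}$, the underlying graph of $G_{i-1}$ is (isomorphic to) an induced subgraph of the underlying graph of $G_i$.
   Context: A trigraph has a vertex set and disjoint sets of black and red edges; its underlying graph has all black and red edges as edges. Contracting $u,v$ produces a vertex $x$ with $xy$ black if $y$ is a black neighbour of both $u$ and $v$, no edge if $y$ is adjacent to neither, and red otherwise. A contraction sequence of $G$ is $G_n=G,\dots,G_1$ with one contraction per step and $G_1$ a single vertex; it is a $1$-contraction sequence if every trigraph has maximum red degree at most $1$. -}

module Defs where

open import Data.Nat using (ℕ; zero; suc)
open import Data.Fin using (Fin; punchIn; _≟_)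
open import Data.Bool using (Bool; true; false)
open import Data.Product using (Σ; _×_; _,_)
open import Data.Unit using (⊤)
open import Relation.Nullary using (¬_; yes; no)
open import Relation.Binary.PropositionalEquality using (_≡_)
open import Function.Definitions using (Injective)

record Graph (n : ℕ) : Set where
  field
    adj   : Fin n → Fin n → Bool
    sym   : ∀ i j → adj i j ≡ adj j i
    irrefl : ∀ i → adj i i ≡ false
open Graph public

data Colour : Set where
  none black red : Colour

-- A trigraph on Fin n: each pair carries no edge / a black edge / a red edge
-- (so black and red edge sets are disjoint by construction).
Trigraph : ℕ → Set
Trigraph n = Fin n → Fin n → Colour

toTrigraph : ∀ {n} → Graph n → Trigraph n
toTrigraph G i j with adj G i j
... | true  = black
... | false = none

-- Colour of xy after contracting u,v into x, given colours uy and vy.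
combine : Colour → Colour → Colour
combine black black = black
combine none  none  = none
combine _     _     = red

-- The result has vertex set Fin m, identified with the vertices ≠ v via
-- punchIn v; the vertex u (i.e. punchIn v j ≡ u) plays the role of the new x.
contract : ∀ {m} → Trigraph (suc m) → Fin (suc m) → Fin (suc m) → Trigraph m
contract T u v j k with j ≟ k
... | yes _ = none
... | no _ with punchIn v j ≟ u | punchIn v k ≟ u
...   | yes _ | _     = combine (T u (punchIn v k)) (T v (punchIn v k))
...   | no _  | yes _ = combine (T (punchIn v j) u) (T (punchIn v j) v)
...   | no _  | no _  = T (punchIn v j) (punchIn v k)

RedDegAtMost1 : ∀ {n} → Trigraph n → Set
RedDegAtMost1 {n} T = ∀ (x y z : Fin n) → T x y ≡ red → T x z ≡ red → y ≡ z

data OneContrSeq : ∀ {m} → Trigraph (suc m) → Set where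
  done : (T : Trigraph 1) → RedDegAtMost1 T → OneContrSeq T
  step : ∀ {m} (T : Trigraph (suc (suc m))) → RedDegAtMost1 T →
         (u v : Fin (suc (suc m))) → ¬ (u ≡ v) →
         OneContrSeq (contract T u v) → OneContrSeq T

AllSteps : (P : ∀ {m} → Trigraph (suc m) → Trigraph m → Set) →
           ∀ {m} {T : Trigraph (suc m)} → OneContrSeq T → Set
AllSteps P (done T _) = ⊤
AllSteps P (step T _ u v _ s) = P T (contract T u v) × AllSteps P s

uadj : ∀ {n} → Trigraph n → Fin n → Fin n → Bool
uadj T i j with T i j
... | none = false
... | _    = true

UnderlyingInducedSub : ∀ {m n} → Trigraph m → Trigraph n → Set
UnderlyingInducedSub {m} {n} H T =
  Σ (Fin m → Fin n) λ f →
    Injective _≡_ _≡_ f × (∀ i j → uadj H i j ≡ uadj T (f i) (f j))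

-- Contract u and v into x. Every red edge at x joins x to a vertex adjacent to
-- exactly one of u, v; since x has at most one red neighbour, no vertex y is a
-- neighbour of u only while another vertex z is a neighbour of v only. Hence
-- (outside {u, v}) one of N(u), N(v) contains the other, x is adjacent exactly
-- to the larger one, and the contracted underlying graph is the underlying graph
-- with the vertex of the smaller neighbourhood deleted.
module Submission where

open import Defs hiding (sym)
open import Data.Nat using (suc)
open import Data.Fin using (Fin; punchIn; punchOut; _≟_)
open import Data.Fin.Properties using (punchIn-injective; punchInᵢ≢i; punchIn-punchOut; any?)
open import Data.Bool using (Bool; true; false; _∨_; _≤_; _<_; b≤b; f≤t; f<t)
open import Data.Bool.Properties using (_<?_; <-asym; ∨-idem)
open import Data.Product using (_,_)
open import Data.Sum using (_⊎_; inj₁; inj₂)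
open import Data.Unit using (tt)
open import Data.Empty using (⊥; ⊥-elim)
open import Relation.Nullary using (¬_; Dec; yes; no)
open import Relation.Nullary.Decidable using (_×-dec_; ¬?)
open import Relation.Unary using (Pred; Decidable)
open import Relation.Binary.PropositionalEquality
  using (_≡_; refl; sym; trans; cong; cong₂; subst; module ≡-Reasoning)
open import Function using (_∘_)
open import Function.Definitions using (Injective)

≮⇒≥ : ∀ {x y} → ¬ x < y → y ≤ x
≮⇒≥ {false} {false} _   = b≤b
≮⇒≥ {false} {true}  x≮y = ⊥-elim (x≮y f<t)
≮⇒≥ {true}  {false} _   = f≤t
≮⇒≥ {true}  {true}  _   = b≤b

y≤x⇒x∨y≡x : ∀ {x y} → y ≤ x → x ∨ y ≡ x
y≤x⇒x∨y≡x {x} b≤b = ∨-idem x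
y≤x⇒x∨y≡x f≤t     = refl

x≤y⇒x∨y≡y : ∀ {x y} → x ≤ y → x ∨ y ≡ y
x≤y⇒x∨y≡y {x} b≤b = ∨-idem x
x≤y⇒x∨y≡y f≤t     = refl

≤-or-≥-unless-crossing : ∀ {m p} {D : Pred (Fin m) p} → Decidable D →
  (a b : Fin m → Bool) →
  (∀ {j k} → D j → D k → a j < b j → b k < a k → ⊥) →
  (∀ k → D k → b k ≤ a k) ⊎ (∀ k → D k → a k ≤ b k)
≤-or-≥-unless-crossing D? a b noCrossing with any? (λ j → D? j ×-dec a j <? b j)
... | no  ¬up               = inj₁ λ k Dk → ≮⇒≥ λ ak<bk → ¬up (k , Dk , ak<bk)
... | yes (j , Dj , aj<bj) = inj₂ λ k Dk → ≮⇒≥ (noCrossing Dj Dk aj<bj)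

isEdge : Colour → Bool
isEdge none  = false
isEdge black = true
isEdge red   = true

uadj≡isEdge : ∀ {n} (T : Trigraph n) i j → uadj T i j ≡ isEdge (T i j)
uadj≡isEdge T i j with T i j
... | none  = refl
... | black = refl
... | red   = refl

isEdge-combine : ∀ c d → isEdge (combine c d) ≡ isEdge c ∨ isEdge d
isEdge-combine none  none  = refl
isEdge-combine none  black = refl
isEdge-combine none  red   = refl
isEdge-combine black none  = refl
isEdge-combine black black = refl
isEdge-combine black red   = refl
isEdge-combine red   none  = refl
isEdge-combine red   black = refl
isEdge-combine red   red   = refl

combine-comm : ∀ c d → combine c d ≡ combine d c
combine-comm none  none  = refl
combine-comm none  black = refl
combine-comm none  red   = refl
combine-comm black none  = refl
combine-comm black black = refl
combine-comm black red   = refl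
combine-comm red   none  = refl
combine-comm red   black = refl
combine-comm red   red   = refl

combine-red : ∀ {c d} → isEdge c < isEdge d → combine c d ≡ red
combine-red {none} {black} f<t = refl
combine-red {none} {red}   f<t = refl

Symmetric : ∀ {n} → Trigraph n → Set
Symmetric T = ∀ i j → T i j ≡ T j i

Loopless : ∀ {n} → Trigraph n → Set
Loopless T = ∀ i → T i i ≡ none

toTrigraph-symmetric : ∀ {n} (G : Graph n) → Symmetric (toTrigraph G)
toTrigraph-symmetric G i j rewrite Graph.sym G i j = refl

toTrigraph-loopless : ∀ {n} (G : Graph n) → Loopless (toTrigraph G)
toTrigraph-loopless G i rewrite irrefl G i = refl

uadj-symmetric : ∀ {n} (T : Trigraph n) → Symmetric T → ∀ i j → uadj T i j ≡ uadj T j i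
uadj-symmetric T S i j rewrite uadj≡isEdge T i j | uadj≡isEdge T j i | S i j = refl

uadj-loopless : ∀ {n} (T : Trigraph n) → Loopless T → ∀ i → uadj T i i ≡ false
uadj-loopless T L i rewrite uadj≡isEdge T i i | L i = refl

module Contraction {m} (T : Trigraph (suc m)) (u v : Fin (suc m)) where

  C : Trigraph m
  C = contract T u v

  old : Fin m → Fin (suc m)
  old = punchIn v

  new-unique : ∀ {j k} → old j ≡ u → old k ≡ u → j ≡ k
  new-unique {j} {k} j≡x k≡x = punchIn-injective v j k (trans j≡x (sym k≡x))

  contract-loopless : Loopless C
  contract-loopless j with j ≟ j
  ... | yes _   = refl
  ... | no  j≢j = ⊥-elim (j≢j refl)

  contract-new-old : ∀ {j k} → old j ≡ u → ¬ old k ≡ u →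
    C j k ≡ combine (T u (old k)) (T v (old k))
  contract-new-old {j} {k} j≡x k≢x with j ≟ k
  ... | yes refl = ⊥-elim (k≢x j≡x)
  ... | no _ with old j ≟ u
  ...   | yes _   = refl
  ...   | no  j≢x = ⊥-elim (j≢x j≡x)

  contract-old-new : ∀ {j k} → ¬ old j ≡ u → old k ≡ u →
    C j k ≡ combine (T (old j) u) (T (old j) v)
  contract-old-new {j} {k} j≢x k≡x with j ≟ k
  ... | yes refl = ⊥-elim (j≢x k≡x)
  ... | no _ with old j ≟ u | old k ≟ u
  ...   | yes j≡x | _       = ⊥-elim (j≢x j≡x)
  ...   | no _    | yes _   = refl
  ...   | no _    | no  k≢x = ⊥-elim (k≢x k≡x)

  contract-old-old : Loopless T → ∀ {j k} → ¬ old j ≡ u → ¬ old k ≡ u →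
    C j k ≡ T (old j) (old k)
  contract-old-old L {j} {k} j≢x k≢x with j ≟ k
  ... | yes refl = sym (L (old j))
  ... | no _ with old j ≟ u | old k ≟ u
  ...   | yes j≡x | _       = ⊥-elim (j≢x j≡x)
  ...   | no _    | yes k≡x = ⊥-elim (k≢x k≡x)
  ...   | no _    | no _    = refl

  contract-symmetric : Symmetric T → Loopless T → Symmetric C
  contract-symmetric S L j k with old j ≟ u | old k ≟ u
  ... | yes j≡x | yes k≡x rewrite new-unique j≡x k≡x = refl
  ... | yes j≡x | no  k≢x = begin
    C j k                                  ≡⟨ contract-new-old j≡x k≢x ⟩
    combine (T u (old k)) (T v (old k))    ≡⟨ cong₂ combine (S u (old k)) (S v (old k)) ⟩
    combine (T (old k) u) (T (old k) v)    ≡⟨ contract-old-new k≢x j≡x ⟨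
    C k j                                  ∎
    where open ≡-Reasoning
  ... | no  j≢x | yes k≡x = begin
    C j k                                  ≡⟨ contract-old-new j≢x k≡x ⟩
    combine (T (old j) u) (T (old j) v)    ≡⟨ cong₂ combine (S (old j) u) (S (old j) v) ⟩
    combine (T u (old j)) (T v (old j))    ≡⟨ contract-new-old k≡x j≢x ⟨
    C k j                                  ∎
    where open ≡-Reasoning
  ... | no  j≢x | no  k≢x = begin
    C j k              ≡⟨ contract-old-old L j≢x k≢x ⟩
    T (old j) (old k)  ≡⟨ S (old j) (old k) ⟩
    T (old k) (old j)  ≡⟨ contract-old-old L k≢x j≢x ⟨
    C k j              ∎
    where open ≡-Reasoning

  uadj-new-old : ∀ {j k} → old j ≡ u → ¬ old k ≡ u →
    uadj C j k ≡ isEdge (T u (old k)) ∨ isEdge (T v (old k))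
  uadj-new-old {j} {k} j≡x k≢x = begin
    uadj C j k                                      ≡⟨ uadj≡isEdge C j k ⟩
    isEdge (C j k)                                  ≡⟨ cong isEdge (contract-new-old j≡x k≢x) ⟩
    isEdge (combine (T u (old k)) (T v (old k)))    ≡⟨ isEdge-combine _ _ ⟩
    isEdge (T u (old k)) ∨ isEdge (T v (old k))     ∎
    where open ≡-Reasoning

  sendNewTo : Fin (suc m) → Fin m → Fin (suc m)
  sendNewTo w j with old j ≟ u
  ... | yes _ = w
  ... | no  _ = old j

  sendNewTo-new : ∀ w {j} → old j ≡ u → sendNewTo w j ≡ w
  sendNewTo-new w {j} j≡x with old j ≟ u
  ... | yes _   = refl
  ... | no  j≢x = ⊥-elim (j≢x j≡x)

  sendNewTo-old : ∀ w {j} → ¬ old j ≡ u → sendNewTo w j ≡ old j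
  sendNewTo-old w {j} j≢x with old j ≟ u
  ... | yes j≡x = ⊥-elim (j≢x j≡x)
  ... | no  _   = refl

  module _ (S : Symmetric T) (L : Loopless T) (w : Fin (suc m))
           (w-fresh : ∀ {k} → ¬ old k ≡ u → ¬ w ≡ old k)
           (N[x]≡N[w] : ∀ {k} → ¬ old k ≡ u →
              isEdge (T u (old k)) ∨ isEdge (T v (old k)) ≡ isEdge (T w (old k))) where

    sendNewTo-injective : Injective _≡_ _≡_ (sendNewTo w)
    sendNewTo-injective {j} {k} eq with old j ≟ u | old k ≟ u
    ... | yes j≡x | yes k≡x = new-unique j≡x k≡x
    ... | yes _   | no  k≢x = ⊥-elim (w-fresh k≢x eq)
    ... | no  j≢x | yes _   = ⊥-elim (w-fresh j≢x (sym eq))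
    ... | no  _   | no  _   = punchIn-injective v j k eq

    uadj-sendNewTo-new-old : ∀ {j k} → old j ≡ u → ¬ old k ≡ u →
      uadj C j k ≡ uadj T (sendNewTo w j) (sendNewTo w k)
    uadj-sendNewTo-new-old {j} {k} j≡x k≢x = begin
      uadj C j k                                    ≡⟨ uadj-new-old j≡x k≢x ⟩
      isEdge (T u (old k)) ∨ isEdge (T v (old k))   ≡⟨ N[x]≡N[w] k≢x ⟩
      isEdge (T w (old k))                          ≡⟨ uadj≡isEdge T w (old k) ⟨
      uadj T w (old k)                              ≡⟨ cong₂ (uadj T) (sendNewTo-new w j≡x) (sendNewTo-old w k≢x) ⟨
      uadj T (sendNewTo w j) (sendNewTo w k)        ∎
      where open ≡-Reasoning

    uadj-sendNewTo : ∀ j k → uadj C j k ≡ uadj T (sendNewTo w j) (sendNewTo w k)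
    uadj-sendNewTo j k = byCases (old j ≟ u) (old k ≟ u)
      where
      open ≡-Reasoning
      byCases : Dec (old j ≡ u) → Dec (old k ≡ u) →
        uadj C j k ≡ uadj T (sendNewTo w j) (sendNewTo w k)
      byCases (yes j≡x) (yes k≡x) rewrite new-unique j≡x k≡x =
        trans (uadj-loopless C contract-loopless k) (sym (uadj-loopless T L (sendNewTo w k)))
      byCases (yes j≡x) (no k≢x) = uadj-sendNewTo-new-old j≡x k≢x
      byCases (no j≢x) (yes k≡x) = begin
        uadj C j k                              ≡⟨ uadj-symmetric C (contract-symmetric S L) j k ⟩
        uadj C k j                              ≡⟨ uadj-sendNewTo-new-old k≡x j≢x ⟩
        uadj T (sendNewTo w k) (sendNewTo w j)  ≡⟨ uadj-symmetric T S _ _ ⟩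
        uadj T (sendNewTo w j) (sendNewTo w k)  ∎
      byCases (no j≢x) (no k≢x) = begin
        uadj C j k                              ≡⟨ uadj≡isEdge C j k ⟩
        isEdge (C j k)                          ≡⟨ cong isEdge (contract-old-old L j≢x k≢x) ⟩
        isEdge (T (old j) (old k))              ≡⟨ uadj≡isEdge T (old j) (old k) ⟨
        uadj T (old j) (old k)                  ≡⟨ cong₂ (uadj T) (sendNewTo-old w j≢x) (sendNewTo-old w k≢x) ⟨
        uadj T (sendNewTo w j) (sendNewTo w k)  ∎

    contract-induced-by-sendNewTo : UnderlyingInducedSub C T
    contract-induced-by-sendNewTo = sendNewTo w , sendNewTo-injective , uadj-sendNewTo

  module _ (S : Symmetric T) (L : Loopless T) (u≢v : ¬ u ≡ v) (redDeg : RedDegAtMost1 C) where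

    private
      a b : Fin m → Bool
      a k = isEdge (T u (old k))
      b k = isEdge (T v (old k))

      x : Fin m
      x = punchOut (u≢v ∘ sym)

      x≡u : old x ≡ u
      x≡u = punchIn-punchOut (u≢v ∘ sym)

    -- A crossing pair would give x two distinct red neighbours.
    noCrossing : ∀ {j k} → ¬ old j ≡ u → ¬ old k ≡ u → a j < b j → b k < a k → ⊥
    noCrossing {j} {k} j≢x k≢x aj<bj bk<ak =
      <-asym aj<bj (subst (λ i → b i < a i) (sym j≡k) bk<ak)
      where
      xj-red : C x j ≡ red
      xj-red = trans (contract-new-old x≡u j≢x) (combine-red aj<bj)

      xk-red : C x k ≡ red
      xk-red = trans (contract-new-old x≡u k≢x) (trans (combine-comm _ _) (combine-red bk<ak))

      j≡k : j ≡ k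
      j≡k = redDeg x j k xj-red xk-red

    contract-induced : UnderlyingInducedSub C T
    contract-induced with ≤-or-≥-unless-crossing (λ k → ¬? (old k ≟ u)) a b noCrossing
    ... | inj₁ b≤a = contract-induced-by-sendNewTo S L u
                       (λ k≢x u≡k → k≢x (sym u≡k))
                       (λ {k} k≢x → y≤x⇒x∨y≡x (b≤a k k≢x))
    ... | inj₂ a≤b = contract-induced-by-sendNewTo S L v
                       (λ {k} _ v≡k → punchInᵢ≢i v k (sym v≡k))
                       (λ {k} k≢x → x≤y⇒x∨y≡y (a≤b k k≢x))

open Contraction using (contract-symmetric; contract-loopless; contract-induced)

redDeg-head : ∀ {m} {T : Trigraph (suc m)} → OneContrSeq T → RedDegAtMost1 T
redDeg-head (done _ redDeg)         = redDeg
redDeg-head (step _ redDeg _ _ _ _) = redDeg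

oneContrSeq-induced : ∀ {m} {T : Trigraph (suc m)} → Symmetric T → Loopless T →
  (s : OneContrSeq T) → AllSteps (λ Gi Gi-1 → UnderlyingInducedSub Gi-1 Gi) s
oneContrSeq-induced S L (done _ _) = tt
oneContrSeq-induced {T = T} S L (step _ _ u v u≢v s) =
  contract-induced T u v S L u≢v (redDeg-head s) ,
  oneContrSeq-induced (contract-symmetric T u v S L) (contract-loopless T u v) s

mainTheorem6 : ∀ {m} (G : Graph (suc m)) (s : OneContrSeq (toTrigraph G)) →
    AllSteps (λ Gi Gi-1 → UnderlyingInducedSub Gi-1 Gi) s
mainTheorem6 G = oneContrSeq-induced (toTrigraph-symmetric G) (toTrigraph-loopless G)
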